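{- Let $k>2$ be an integer. Let $p_1<p_2<p_3<\cdots$ be the elements of $\widehat{P}$ in increasing order, with $a_i=H(p_i)$ (so $a_1<a_2<\cdots$; e.g. $(p_1,a_1)=(3,2)$, $(p_2,a_2)=(7,3)$, $(p_3,a_3)=(19,4)$, $(p_4,a_4)=(163,6)$), and let $r$ be the largest index with $a_r\le k$. Then the largest elements of $C_k$, in decreasing order, are $$2\cdot 3^{k-a_1}p_1=2\cdot 3^{k-1},\ 2\cdot 3^{k-a_2}p_2,\ \dots,\ 2\cdot 3^{k-a_r}p_r,\ 2^2\cdot 3^{k-2};$$ that is, these $r+1$ numbers are strictly decreasing, all lie in $C_k$, and every other element of $C_k$ is smaller than $2^2\cdot 3^{k-2}$.
   Context: Let $\varphi$ be Euler's totient function. The height function $H$ on positive integers is defined by $H(1)=0$ and $H(n)=H(\varphi(n))+1$ for $n\ge 2$, and $C_k=\{n : H(n)=k\}$. Let $\widehat{P}$ be the set of primes $p$ such that $p=2\cdot 3^{j-2}+1$ for some integer $j\ge 2$. -}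

module Defs where

open import Data.Nat using (ℕ; zero; suc; _+_; _*_; _∸_; _^_; _≤_; _<_; _≤?_)
open import Data.Nat.GCD using (gcd)
open import Data.Nat.Primality using (Prime)
open import Data.List using (List; length; filter; upTo; map)
open import Data.Product using (Σ; _×_; ∃; ∃-syntax)
open import Relation.Binary.PropositionalEquality using (_≡_)
open import Relation.Nullary using (yes; no)

-- Euler's totient: φ n = #{ m : 1 ≤ m ≤ n , gcd m n = 1 }  (so φ 1 = 1, φ 0 = 0)
φ : ℕ → ℕ
φ n = length (filter (λ m → gcd m n Data.Nat.≟ 1) (map suc (upTo n)))

-- Height with fuel: Hf f n iterates φ until reaching a value ≤ 1.
-- Since φ n < n for n ≥ 2, fuel n suffices, so H satisfies
-- H 1 = 0 and H n = H (φ n) + 1 for n ≥ 2.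
Hf : ℕ → ℕ → ℕ
Hf zero n = 0
Hf (suc f) n with n ≤? 1
... | yes _ = 0
... | no _ = suc (Hf f (φ n))

H : ℕ → ℕ
H n = Hf n n

InC : ℕ → ℕ → Set
InC k n = (1 ≤ n) × (H n ≡ k)

InPhat : ℕ → Set
InPhat p = Prime p × ∃[ j ] ((2 ≤ j) × (p ≡ 2 * 3 ^ (j ∸ 2) + 1))

-- Up to a parity correction, H is Shapiro's completely additive function α: α 2 = α 3 = 1
-- and α p = α (p − 1) for odd primes p, because φ (p n) is p φ n or (p − 1) φ n and φ n is
-- even for n ≥ 3.  Factor by factor, n ≤ 3 ^ α n; moreover 9 n ≤ 7 · 3 ^ α n unless n is a
-- power of 3, and 3 p < 2 · 3 ^ α p for odd primes p ∉ P̂.  An odd n ∈ C_k has α n = k − 1,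
-- so n ≤ 3 ^ (k − 1) < 4 · 3 ^ (k − 2).  An even n = 2 m ∈ C_k with n ≥ 4 · 3 ^ (k − 2)
-- has α m = k − 1 and 2 · 3 ^ α m ≤ 3 m, which these bounds allow only for m = 3 ^ i,
-- 2 · 3 ^ i or 3 ^ i p with p ∈ P̂: exactly the listed numbers.  They are ordered by
-- 2 · 3 ^ (k − H p) p = 4 · 3 ^ (k − 2) + 2 · 3 ^ (k − H p), as H (1 + 2 · 3 ^ j) = j + 2.

module Submission where

open import Defs
open import Data.Nat
open import Data.Nat.Properties
open import Data.Nat.Divisibility
open import Data.Nat.GCD using (gcd)
open import Data.Nat.Coprimality using (Coprime; coprime?; coprime-+; coprime⇒gcd≡1; gcd≡1⇒coprime; coprime-divisor)
open import Data.Nat.Primality using (Prime; prime?; prime[2]; prime⇒nonTrivial; prime⇒irreducible; euclidsLemma)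
open import Data.Nat.Primality.Factorisation using (factorise)
open import Data.Nat.Induction using (<-rec)
open import Data.Nat.ListAction using (product)
open import Data.List using (length; filter; map; applyUpTo; []; _∷_)
open import Data.List.Relation.Unary.All using (_∷_)
open import Algebra.Properties.CommutativeSemigroup +-commutativeSemigroup using (interchange)
open import Data.Product using (∃-syntax; _×_; _,_; proj₁; proj₂)
open import Data.Sum using (_⊎_; inj₁; inj₂; [_,_]′)
open import Function using (_∘_)
open import Function.Bundles using (_⇔_; mk⇔; module Equivalence)
open import Level using (0ℓ)
open import Data.Nat.Tactic.RingSolver using (solve-∀)
open import Relation.Binary.PropositionalEquality using (_≡_; _≢_; refl; sym; trans; cong; cong₂; subst; subst₂)
open import Relation.Nullary using (Dec; yes; no; ¬_; contradiction; _×-dec_)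
open import Relation.Nullary.Decidable using (from-yes; from-no)
open import Relation.Unary using (Pred; Decidable)
open import Relation.Unary.Properties using (_∩?_; ∁?)

open Equivalence using (to; from)
open ≤-Reasoning

private
  variable
    P Q : Pred ℕ 0ℓ
    m n p : ℕ

-- Counting

indicator : {A : Set} → Dec A → ℕ
indicator (yes _) = 1
indicator (no _)  = 0

indicator-cong : {A B : Set} (a? : Dec A) (b? : Dec B) → A ⇔ B → indicator a? ≡ indicator b?
indicator-cong (yes _) (yes _) _  = refl
indicator-cong (no _)  (no _)  _  = refl
indicator-cong (yes a) (no ¬b) a⇔b = contradiction (to a⇔b a) ¬b
indicator-cong (no ¬a) (yes b) a⇔b = contradiction (from a⇔b b) ¬a

indicator-yes : {A : Set} (a? : Dec A) → A → indicator a? ≡ 1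
indicator-yes (yes _) _ = refl
indicator-yes (no ¬a) a = contradiction a ¬a

indicator-no : {A : Set} (a? : Dec A) → ¬ A → indicator a? ≡ 0
indicator-no (yes a) ¬a = contradiction a ¬a
indicator-no (no _)  _  = refl

-- The number of m < n (not m ≤ n) with P m.
count : Decidable P → ℕ → ℕ
count P? zero    = 0
count P? (suc n) = indicator (P? 0) + count (λ m → P? (suc m)) n

count-cong : (P? : Decidable P) (Q? : Decidable Q) → (∀ m → P m ⇔ Q m) → ∀ n → count P? n ≡ count Q? n
count-cong P? Q? P⇔Q zero    = refl
count-cong P? Q? P⇔Q (suc n) =
  cong₂ _+_ (indicator-cong (P? 0) (Q? 0) (P⇔Q 0)) (count-cong _ _ (P⇔Q ∘ suc) n)

count-+ : (P? : Decidable P) (a b : ℕ) → count P? (a + b) ≡ count P? a + count (λ m → P? (a + m)) b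
count-+ P? zero    b = refl
count-+ P? (suc a) b =
  trans (cong (indicator (P? 0) +_) (count-+ (λ m → P? (suc m)) a b)) (sym (+-assoc (indicator (P? 0)) _ _))

count≤ : (P? : Decidable P) (n : ℕ) → count P? n ≤ n
count≤ P? zero    = z≤n
count≤ P? (suc n) with P? 0
... | yes _ = s≤s (count≤ _ n)
... | no _  = m≤n⇒m≤1+n (count≤ _ n)

count>0 : (P? : Decidable P) → m < n → P m → 0 < count P? n
count>0 {m = zero}  P? (s≤s _)   Pm with P? 0
... | yes _ = s≤s z≤n
... | no ¬P0 = contradiction Pm ¬P0
count>0 {m = suc m} P? (s≤s m<n) Pm = ≤-trans (count>0 _ m<n Pm) (m≤n+m _ _)

count≡0 : (P? : Decidable P) (n : ℕ) → (∀ m → m < n → ¬ P m) → count P? n ≡ 0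
count≡0 P? zero    none = refl
count≡0 P? (suc n) none with P? 0
... | yes P0 = contradiction P0 (none 0 z<s)
... | no _   = count≡0 _ n (λ m m<n → none (suc m) (s≤s m<n))

count-partition : (P? : Decidable P) (Q? : Decidable Q) (n : ℕ) →
  count P? n ≡ count (P? ∩? Q?) n + count (P? ∩? ∁? Q?) n
count-partition P? Q? zero = refl
count-partition P? Q? (suc n) with P? 0 | Q? 0 | count-partition (λ m → P? (suc m)) (λ m → Q? (suc m)) n
... | yes _ | yes _ | ih = cong suc ih
... | yes _ | no _  | ih = trans (cong suc ih) (sym (+-suc _ _))
... | no _  | yes _ | ih = ih
... | no _  | no _  | ih = ih

count-periodic : (P? : Decidable P) (d : ℕ) → (∀ m → P (d + m) ⇔ P m) →
  ∀ q → count P? (q * d) ≡ q * count P? d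
count-periodic P? d periodic zero    = refl
count-periodic P? d periodic (suc q) = begin-equality
  count P? (d + q * d)                          ≡⟨ count-+ P? d (q * d) ⟩
  count P? d + count (λ m → P? (d + m)) (q * d) ≡⟨ cong (count P? d +_) (count-cong _ P? periodic (q * d)) ⟩
  count P? d + count P? (q * d)                 ≡⟨ cong (count P? d +_) (count-periodic P? d periodic q) ⟩
  count P? d + q * count P? d                   ∎

count-rotate : (P? : Decidable P) (n : ℕ) → P 0 ⇔ P n → count (λ m → P? (suc m)) n ≡ count P? n
count-rotate {P} P? n P0⇔Pn = +-cancelˡ-≡ (indicator (P? 0)) _ _ (begin-equality
  indicator (P? 0) + count (λ m → P? (suc m)) n  ≡⟨ cong (count P?) (+-comm 1 n) ⟩
  count P? (n + 1)                               ≡⟨ count-+ P? n 1 ⟩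
  count P? n + (indicator (P? (n + 0)) + 0)       ≡⟨ cong (count P? n +_) (+-identityʳ _) ⟩
  count P? n + indicator (P? (n + 0))             ≡⟨ cong (count P? n +_) (indicator-cong _ (P? 0) Pn⇔P0) ⟩
  count P? n + indicator (P? 0)                   ≡⟨ +-comm (count P? n) _ ⟩
  indicator (P? 0) + count P? n                   ∎)
  where
  Pn⇔P0 : P (n + 0) ⇔ P 0
  Pn⇔P0 = mk⇔ (λ Pn → from P0⇔Pn (subst P (+-identityʳ n) Pn)) (λ P0 → subst P (sym (+-identityʳ n)) (to P0⇔Pn P0))

count-multiples : (P? : Decidable P) (p : ℕ) .{{_ : NonZero p}} (n : ℕ) →
  count (P? ∩? (p ∣?_)) (p * n) ≡ count (λ t → P? (p * t)) n
count-multiples P? p zero = cong (count (P? ∩? (p ∣?_))) (*-zeroʳ p)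
count-multiples {P} P? p@(suc p′) (suc n) = begin-equality
  count (P? ∩? (p ∣?_)) (p * suc n)
    ≡⟨ cong (count (P? ∩? (p ∣?_))) (*-suc p n) ⟩
  count (P? ∩? (p ∣?_)) (p + p * n)
    ≡⟨ count-+ (P? ∩? (p ∣?_)) p (p * n) ⟩
  count (P? ∩? (p ∣?_)) p + count (λ m → (P? ∩? (p ∣?_)) (p + m)) (p * n)
    ≡⟨ cong₂ _+_ firstBlock (count-cong _ _ shift (p * n)) ⟩
  indicator (P? 0) + count ((λ m → P? (p + m)) ∩? (p ∣?_)) (p * n)
    ≡⟨ cong (indicator (P? 0) +_) (count-multiples (λ m → P? (p + m)) p n) ⟩
  indicator (P? 0) + count (λ t → P? (p + p * t)) n
    ≡⟨ cong₂ _+_ (indicator-cong (P? 0) (P? (p * 0)) (≡⇒⇔ (sym (*-zeroʳ p))))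
                 (count-cong _ _ (λ t → ≡⇒⇔ (sym (*-suc p t))) n) ⟩
  indicator (P? (p * 0)) + count (λ t → P? (p * suc t)) n
    ∎
  where
  ≡⇒⇔ : ∀ {a b} → a ≡ b → P a ⇔ P b
  ≡⇒⇔ refl = mk⇔ (λ x → x) (λ x → x)
  shift : ∀ m → (P (p + m) × p ∣ p + m) ⇔ (P (p + m) × p ∣ m)
  shift m = mk⇔ (λ (Pm , p∣p+m) → Pm , ∣m+n∣m⇒∣n p∣p+m ∣-refl)
                (λ (Pm , p∣m) → Pm , ∣m∣n⇒∣m+n ∣-refl p∣m)
  firstBlock : count (P? ∩? (p ∣?_)) p ≡ indicator (P? 0)
  firstBlock = trans (cong₂ _+_
    (indicator-cong (P? 0 ×-dec p ∣? 0) (P? 0) (mk⇔ proj₁ (_, p ∣0)))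
    (count≡0 _ p′ (λ m m<p′ (_ , p∣1+m) → <⇒≱ (s≤s m<p′) (∣⇒≤ p∣1+m))))
    (+-identityʳ _)

-- Primes and factorisation

prime>1 : Prime p → 1 < p
prime>1 {p} pr = nonTrivial⇒n>1 p {{prime⇒nonTrivial pr}}

prime>0 : Prime p → 0 < p
prime>0 pr = <⇒≤ (prime>1 pr)

m*n>0⇒n>0 : ∀ m {n} → 0 < m * n → 0 < n
m*n>0⇒n>0 m {zero}  m*0>0 = contradiction (*-zeroʳ m) (>⇒≢ m*0>0)
m*n>0⇒n>0 m {suc n} _     = z<s

pred[n]<n : 0 < n → pred n < n
pred[n]<n {suc n} _ = n<1+n n

m<p*m : Prime p → 0 < m → m < p * m
m<p*m {p} {m} pr m>0 = subst (m <_) (*-comm m p) (m<m*n m p {{>-nonZero m>0}} (prime>1 pr))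

p≤p*m : 0 < m → p ≤ p * m
p≤p*m {m} {p} m>0 = m≤m*n p m {{>-nonZero m>0}}

primeFactor : 2 ≤ n → ∃[ p ] ∃[ m ] Prime p × n ≡ p * m
primeFactor {n} 2≤n with factorise n {{>-nonZero (<-trans z<s 2≤n)}}
... | record { factors = [] ; isFactorisation = n≡1 } = contradiction n≡1 (>⇒≢ 2≤n)
... | record { factors = p ∷ ps ; isFactorisation = n≡p*ps ; factorsPrime = pr ∷ _ } =
  p , product ps , pr , n≡p*ps

factor-induction : (P : Pred ℕ 0ℓ) → P 1 →
  (∀ {p m} → Prime p → 0 < m → (∀ {k} → 0 < k → k < p → P k) → P m → P (p * m)) →
  0 < n → P n
factor-induction {n} P P1 step = <-rec (λ n → 0 < n → P n) go n
  where
  go : ∀ n → (∀ {k} → k < n → 0 < k → P k) → 0 < n → P n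
  go (suc zero)        _  _ = P1
  go n@(suc (suc _))   ih _ with primeFactor {n} (s≤s (s≤s z≤n))
  ... | p , m , pr , n≡pm = subst P (sym n≡pm)
    (step pr m>0 (λ k>0 k<p → ih (<-≤-trans k<p (subst (p ≤_) (sym n≡pm) (p≤p*m m>0))) k>0)
                 (ih (subst (m <_) (sym n≡pm) (m<p*m pr m>0)) m>0))
    where
    m>0 : 0 < m
    m>0 = m*n>0⇒n>0 p (subst (0 <_) n≡pm z<s)

even⊎odd : ∀ n → ∃[ q ] (n ≡ 2 * q ⊎ n ≡ suc (2 * q))
even⊎odd zero = 0 , inj₁ refl
even⊎odd (suc n) with even⊎odd n
... | q , inj₁ n≡2q   = q , inj₂ (cong suc n≡2q)
... | q , inj₂ n≡1+2q = suc q , inj₁ (trans (cong suc n≡1+2q) (sym (*-suc 2 q)))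

2∤1+2*q : ∀ q → 2 ∤ suc (2 * q)
2∤1+2*q q 2∣1+2q = contradiction (∣1⇒≡1 (∣m+n∣m⇒∣n (subst (2 ∣_) (+-comm 1 (2 * q)) 2∣1+2q) (m∣m*n q))) λ ()

2∣p⇒p≡2 : Prime p → 2 ∣ p → p ≡ 2
2∣p⇒p≡2 pr 2∣p = [ (λ ()) , sym ]′ (prime⇒irreducible pr 2∣p)

odd-prime≡1+2q : Prime p → p ≢ 2 → ∃[ q ] 0 < q × p ≡ suc (2 * q)
odd-prime≡1+2q {p} pr p≢2 with even⊎odd p
... | q     , inj₁ p≡2q  = contradiction (2∣p⇒p≡2 pr (divides q (trans p≡2q (*-comm 2 q)))) p≢2
... | zero  , inj₂ p≡1   = contradiction p≡1 (>⇒≢ (prime>1 pr))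
... | suc q , inj₂ p≡1+2q = suc q , z<s , p≡1+2q

-- Euler's totient

length-filter-map-applyUpTo : (P? : Decidable P) (f g : ℕ → ℕ) (n : ℕ) →
  length (filter P? (map f (applyUpTo g n))) ≡ count (λ m → P? (f (g m))) n
length-filter-map-applyUpTo P? f g zero = refl
length-filter-map-applyUpTo P? f g (suc n) with P? (f (g 0))
... | yes _ = cong suc (length-filter-map-applyUpTo P? f (g ∘ suc) n)
... | no _  = length-filter-map-applyUpTo P? f (g ∘ suc) n

coprime-* : ∀ {a b} → Coprime m (a * b) ⇔ (Coprime m a × Coprime m b)
coprime-* {a = a} {b} = mk⇔
  (λ c → (λ {_} (d∣m , d∣a) → c (d∣m , ∣-trans d∣a (m∣m*n b)))
       , (λ {_} (d∣m , d∣b) → c (d∣m , ∣-trans d∣b (n∣m*n a))))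
  (λ (ca , cb) {_} (d∣m , d∣ab) →
     cb (d∣m , coprime-divisor (λ {_} (e∣d , e∣a) → ca (∣-trans e∣d d∣m , e∣a)) d∣ab))

coprime-prime : Prime p → Coprime m p ⇔ p ∤ m
coprime-prime pr = mk⇔
  (λ c p∣m → <⇒≢ (prime>1 pr) (sym (c (p∣m , ∣-refl))))
  (λ p∤m {_} (d∣m , d∣p) → [ (λ d≡1 → d≡1) , (λ d≡p → contradiction (subst (_∣ _) d≡p d∣m) p∤m) ]′
                          (prime⇒irreducible pr d∣p))

coprime-+ˡ : Coprime (n + m) n ⇔ Coprime m n
coprime-+ˡ = mk⇔ (λ c {_} (d∣m , d∣n) → c (∣m∣n⇒∣m+n d∣n d∣m , d∣n)) coprime-+

coprime-*ˡ : ∀ {t} → Prime p → p ∤ n → Coprime (p * t) n ⇔ Coprime t n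
coprime-*ˡ {p = p} pr p∤n = mk⇔
  (λ c {_} (d∣t , d∣n) → c (∣-trans d∣t (n∣m*n p) , d∣n))
  (λ c {_} (d∣pt , d∣n) → c (coprime-divisor (from (coprime-prime pr) (λ p∣d → p∤n (∣-trans p∣d d∣n))) d∣pt , d∣n))

φ≡count : ∀ n → φ n ≡ count (λ m → coprime? m n) n
φ≡count n = begin-equality
  φ n                                 ≡⟨ length-filter-map-applyUpTo _ suc (λ m → m) n ⟩
  count (λ m → gcd (suc m) n ≟ 1) n    ≡⟨ count-cong _ _ (λ _ → mk⇔ gcd≡1⇒coprime coprime⇒gcd≡1) n ⟩
  count (λ m → coprime? (suc m) n) n  ≡⟨ count-rotate (λ m → coprime? m n) n 0⇔n ⟩
  count (λ m → coprime? m n) n        ∎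
  where
  0⇔n : Coprime 0 n ⇔ Coprime n n
  0⇔n = mk⇔ (λ c {_} (d∣n , _) → c (_ ∣0 , d∣n)) (λ c {_} (_ , d∣n) → c (d∣n , d∣n))

φ[n]≤n : ∀ n → φ n ≤ n
φ[n]≤n n = subst (_≤ n) (sym (φ≡count n)) (count≤ _ n)

φ[n]<n : 2 ≤ n → φ n < n
φ[n]<n {suc n} (s≤s 1≤n) with coprime? 0 (suc n) | φ≡count (suc n)
... | yes c | _      = contradiction (c (_ ∣0 , ∣-refl)) (>⇒≢ (s≤s 1≤n))
... | no _  | φ≡ = s≤s (subst (_≤ n) (sym φ≡) (count≤ _ n))

φ[n]>0 : 0 < n → 0 < φ n
φ[n]>0 {suc zero}    _ = s≤s z≤n
φ[n]>0 {suc (suc n)} _ = subst (0 <_) (sym (φ≡count (2 + n)))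
  (count>0 {n = 2 + n} (λ m → coprime? m (2 + n)) (s≤s (s≤s z≤n)) (λ (d∣1 , _) → ∣1⇒≡1 d∣1))

p∣n⇒φ[p*n]≡p*φ[n] : Prime p → p ∣ n → φ (p * n) ≡ p * φ n
p∣n⇒φ[p*n]≡p*φ[n] {p} {n} pr p∣n = begin-equality
  φ (p * n)                                ≡⟨ φ≡count (p * n) ⟩
  count (λ m → coprime? m (p * n)) (p * n) ≡⟨ count-cong _ _ coprime[pn]⇔coprime[n] (p * n) ⟩
  count (λ m → coprime? m n) (p * n)       ≡⟨ count-periodic _ n (λ _ → coprime-+ˡ) p ⟩
  p * count (λ m → coprime? m n) n         ≡⟨ cong (p *_) (φ≡count n) ⟨
  p * φ n                                  ∎
  where
  coprime[pn]⇔coprime[n] : ∀ m → Coprime m (p * n) ⇔ Coprime m n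
  coprime[pn]⇔coprime[n] m = mk⇔ (proj₂ ∘ to (coprime-* {m} {p} {n}))
    (λ c → from (coprime-* {m} {p} {n}) (from (coprime-prime pr) (λ p∣m → <⇒≢ (prime>1 pr) (sym (c (p∣m , p∣n)))) , c))

p∤n⇒φ[p*n]≡pred[p]*φ[n] : Prime p → p ∤ n → φ (p * n) ≡ pred p * φ n
p∤n⇒φ[p*n]≡pred[p]*φ[n] {p} {n} pr p∤n = begin-equality
  φ (p * n)                 ≡⟨ m+n∸n≡m (φ (p * n)) (φ n) ⟨
  φ (p * n) + φ n ∸ φ n     ≡⟨ cong (_∸ φ n) sum ⟩
  p * φ n ∸ φ n             ≡⟨ cong (p * φ n ∸_) (*-identityˡ (φ n)) ⟨
  p * φ n ∸ 1 * φ n         ≡⟨ *-distribʳ-∸ (φ n) p 1 ⟨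
  pred p * φ n              ∎
  where
  C? : Decidable (λ m → Coprime m n)
  C? m = coprime? m n
  sum : φ (p * n) + φ n ≡ p * φ n
  sum = begin-equality
    φ (p * n) + φ n
      ≡⟨ cong₂ _+_ (trans (φ≡count (p * n)) (count-cong _ _ coprime[pn]⇔ (p * n))) (φ≡count n) ⟩
    count (C? ∩? ∁? (p ∣?_)) (p * n) + count C? n
      ≡⟨ cong (count (C? ∩? ∁? (p ∣?_)) (p * n) +_) multiples ⟨
    count (C? ∩? ∁? (p ∣?_)) (p * n) + count (C? ∩? (p ∣?_)) (p * n)
      ≡⟨ +-comm (count (C? ∩? ∁? (p ∣?_)) (p * n)) _ ⟩
    count (C? ∩? (p ∣?_)) (p * n) + count (C? ∩? ∁? (p ∣?_)) (p * n)
      ≡⟨ count-partition C? (p ∣?_) (p * n) ⟨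
    count C? (p * n)
      ≡⟨ count-periodic C? n (λ _ → coprime-+ˡ) p ⟩
    p * count C? n
      ≡⟨ cong (p *_) (φ≡count n) ⟨
    p * φ n ∎
    where
    instance
      p≢0 : NonZero p
      p≢0 = >-nonZero (prime>0 pr)
    coprime[pn]⇔ : ∀ m → Coprime m (p * n) ⇔ (Coprime m n × p ∤ m)
    coprime[pn]⇔ m = mk⇔ forward backward
      where
      forward : Coprime m (p * n) → Coprime m n × p ∤ m
      forward c = let (cp , cn) = to coprime-* c in cn , to (coprime-prime pr) cp
      backward : Coprime m n × p ∤ m → Coprime m (p * n)
      backward (cn , p∤m) = from coprime-* (from (coprime-prime pr) p∤m , cn)
    multiples : count (C? ∩? (p ∣?_)) (p * n) ≡ count C? n
    multiples = trans (count-multiples C? p n) (count-cong _ _ (λ _ → coprime-*ˡ pr p∤n) n)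

φ[p]≡pred[p] : Prime p → φ p ≡ pred p
φ[p]≡pred[p] {p} pr = begin-equality
  φ p              ≡⟨ cong φ (*-identityʳ p) ⟨
  φ (p * 1)        ≡⟨ p∤n⇒φ[p*n]≡pred[p]*φ[n] pr (λ p∣1 → >⇒≢ (prime>1 pr) (∣1⇒≡1 p∣1)) ⟩
  pred p * 1       ≡⟨ *-identityʳ (pred p) ⟩
  pred p           ∎

2∣φ[n] : 3 ≤ n → 2 ∣ φ n
2∣φ[n] n≥3 = factor-induction (λ n → 3 ≤ n → 2 ∣ φ n) (λ { (s≤s ()) }) step (≤-trans (s≤s z≤n) n≥3) n≥3
  where
  step : ∀ {p m} → Prime p → 0 < m → (∀ {k} → 0 < k → k < p → 3 ≤ k → 2 ∣ φ k) →
    (3 ≤ m → 2 ∣ φ m) → 3 ≤ p * m → 2 ∣ φ (p * m)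
  step {p} {m} pr m>0 _ ih pm≥3 with p ∣? m | p ≟ 2
  ... | yes p∣m | yes refl = subst (2 ∣_) (sym (p∣n⇒φ[p*n]≡p*φ[n] pr p∣m)) (m∣m*n (φ m))
  ... | yes p∣m | no p≢2   = subst (2 ∣_) (sym (p∣n⇒φ[p*n]≡p*φ[n] pr p∣m)) (∣-trans (ih m≥3) (n∣m*n p))
    where
    m≥3 : 3 ≤ m
    m≥3 = let q , q>0 , p≡1+2q = odd-prime≡1+2q pr p≢2 in
      ≤-trans (subst (3 ≤_) (sym p≡1+2q) (s≤s (*-monoʳ-≤ 2 q>0))) (∣⇒≤ {{>-nonZero m>0}} p∣m)
  ... | no p∤m  | yes refl = subst (2 ∣_) (sym (trans (p∤n⇒φ[p*n]≡pred[p]*φ[n] pr p∤m) (*-identityˡ (φ m)))) (ih m≥3)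
    where
    m≥3 : 3 ≤ m
    m≥3 = ≤∧≢⇒< (*-cancelˡ-< 2 1 m pm≥3) (λ 2≡m → p∤m (subst (2 ∣_) 2≡m ∣-refl))
  ... | no p∤m  | no p≢2   = subst (2 ∣_) (sym (p∤n⇒φ[p*n]≡pred[p]*φ[n] pr p∤m)) (∣-trans 2∣pred[p] (m∣m*n (φ m)))
    where
    2∣pred[p] : 2 ∣ pred p
    2∣pred[p] = let q , _ , p≡1+2q = odd-prime≡1+2q pr p≢2 in divides q (trans (cong pred p≡1+2q) (*-comm 2 q))

-- The height H and Shapiro's function α

Hf[f,0]≡0 : ∀ f → Hf f 0 ≡ 0
Hf[f,0]≡0 zero    = refl
Hf[f,0]≡0 (suc f) = refl

Hf-fuel-irrelevant : ∀ f g n → n ≤ f → n ≤ g → Hf f n ≡ Hf g n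
Hf-fuel-irrelevant zero    g       zero _ _ = sym (Hf[f,0]≡0 g)
Hf-fuel-irrelevant (suc f) zero    zero _ _ = refl
Hf-fuel-irrelevant (suc f) (suc g) n n≤f n≤g with n ≤? 1
... | yes _   = refl
... | no  n≰1 = cong suc (Hf-fuel-irrelevant f g (φ n) (φn≤ n≤f) (φn≤ n≤g))
  where
  φn≤ : ∀ {h} → n ≤ suc h → φ n ≤ h
  φn≤ n≤1+h = ≤-pred (≤-trans (φ[n]<n (≰⇒> n≰1)) n≤1+h)

H[n]≡1+H[φn] : 2 ≤ n → H n ≡ suc (H (φ n))
H[n]≡1+H[φn] {suc n} n≥2 with suc n ≤? 1
... | yes n≤1 = contradiction n≤1 (<⇒≱ n≥2)
... | no  _   = cong suc (Hf-fuel-irrelevant n (φ (suc n)) (φ (suc n)) (≤-pred (φ[n]<n n≥2)) ≤-refl)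

-- α n = H n for even n and α n = H n − 1 for odd n ≥ 3.
α : ℕ → ℕ
α n = pred (H n + indicator (2 ∣? n))

H≡α : 2 ∣ n → H n ≡ α n
H≡α {n} 2∣n = begin-equality
  H n                    ≡⟨ m+n∸n≡m (H n) 1 ⟨
  pred (H n + 1)         ≡⟨ cong (λ e → pred (H n + e)) (indicator-yes (2 ∣? n) 2∣n) ⟨
  α n                    ∎

H≡1+α : 2 ≤ n → 2 ∤ n → H n ≡ suc (α n)
H≡1+α {n} n≥2 2∤n = begin-equality
  H n                     ≡⟨ H[n]≡1+H[φn] n≥2 ⟩
  suc (H (φ n))           ≡⟨ cong (suc ∘ pred) (H[n]≡1+H[φn] n≥2) ⟨
  suc (pred (H n))        ≡⟨ cong (suc ∘ pred) (+-identityʳ (H n)) ⟨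
  suc (pred (H n + 0))    ≡⟨ cong (λ e → suc (pred (H n + e))) (indicator-no (2 ∣? n) 2∤n) ⟨
  suc (α n)               ∎

H>0⇒n≥2 : 0 < n → 0 < H n → 2 ≤ n
H>0⇒n≥2 {suc (suc _)} _ _ = s≤s (s≤s z≤n)

α[n]≡α[φn]+[2∣n] : 0 < n → α n ≡ α (φ n) + indicator (2 ∣? n)
α[n]≡α[φn]+[2∣n] {1} _ = refl
α[n]≡α[φn]+[2∣n] {2} _ = refl
α[n]≡α[φn]+[2∣n] {n@(suc (suc (suc _)))} _ = begin-equality
  pred (H n + indicator (2 ∣? n))           ≡⟨ cong (λ h → pred (h + indicator (2 ∣? n))) (H[n]≡1+H[φn] {n} (s≤s (s≤s z≤n))) ⟩
  H (φ n) + indicator (2 ∣? n)              ≡⟨ cong (_+ indicator (2 ∣? n)) (H≡α (2∣φ[n] {n} (s≤s (s≤s (s≤s z≤n))))) ⟩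
  α (φ n) + indicator (2 ∣? n)              ∎

α[p]≡α[p∸1]+[2∣p] : Prime p → α p ≡ α (pred p) + indicator (2 ∣? p)
α[p]≡α[p∸1]+[2∣p] {p} pr =
  trans (α[n]≡α[φn]+[2∣n] (prime>0 pr)) (cong (λ e → α e + indicator (2 ∣? p)) (φ[p]≡pred[p] pr))

[2∣a*b]≡[2∣a]+[2∣b] : ∀ {a b} → ¬ (2 ∣ a × 2 ∣ b) →
  indicator (2 ∣? (a * b)) ≡ indicator (2 ∣? a) + indicator (2 ∣? b)
[2∣a*b]≡[2∣a]+[2∣b] {a} {b} notBoth with 2 ∣? a | 2 ∣? b
... | yes 2∣a | yes 2∣b = contradiction (2∣a , 2∣b) notBoth
... | yes 2∣a | no _    = indicator-yes (2 ∣? (a * b)) (∣-trans 2∣a (m∣m*n b))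
... | no _    | yes 2∣b = indicator-yes (2 ∣? (a * b)) (∣-trans 2∣b (n∣m*n a))
... | no 2∤a  | no 2∤b  = indicator-no (2 ∣? (a * b)) ([ 2∤a , 2∤b ]′ ∘ euclidsLemma a b prime[2])

[2∣a*b]≡[2∣b] : ∀ {a b} → a ∣ b → indicator (2 ∣? (a * b)) ≡ indicator (2 ∣? b)
[2∣a*b]≡[2∣b] {a} {b} a∣b with 2 ∣? a
... | yes 2∣a = trans (indicator-yes (2 ∣? (a * b)) (∣-trans 2∣a (m∣m*n b)))
                      (sym (indicator-yes (2 ∣? b) (∣-trans 2∣a a∣b)))
... | no 2∤a  = trans ([2∣a*b]≡[2∣a]+[2∣b] (2∤a ∘ proj₁)) (cong (_+ indicator (2 ∣? b)) (indicator-no (2 ∣? a) 2∤a))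

AdditiveBelow : ℕ → Set
AdditiveBelow N = ∀ {a b} → 0 < a → 0 < b → a * b < N → α (a * b) ≡ α a + α b

α[p*n]≡α[p]+α[n] : ∀ {N} → AdditiveBelow N → Prime p → 0 < n → p * n ≤ N → α (p * n) ≡ α p + α n
α[p*n]≡α[p]+α[n] {p} {n} {N} additive pr n>0 pn≤N with p ∣? n
... | yes p∣n = begin-equality
  α (p * n)                                   ≡⟨ α[n]≡α[φn]+[2∣n] pn>0 ⟩
  α (φ (p * n)) + indicator (2 ∣? (p * n))    ≡⟨ cong₂ _+_ (cong α (p∣n⇒φ[p*n]≡p*φ[n] pr p∣n)) ([2∣a*b]≡[2∣b] p∣n) ⟩
  α (p * φ n) + indicator (2 ∣? n)            ≡⟨ cong (_+ indicator (2 ∣? n)) (additive p>0 (φ[n]>0 n>0) lt) ⟩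
  α p + α (φ n) + indicator (2 ∣? n)          ≡⟨ +-assoc (α p) _ _ ⟩
  α p + (α (φ n) + indicator (2 ∣? n))        ≡⟨ cong (α p +_) (α[n]≡α[φn]+[2∣n] n>0) ⟨
  α p + α n                                   ∎
  where
  p>0 : 0 < p
  p>0 = prime>0 pr
  pn>0 : 0 < p * n
  pn>0 = *-mono-≤ p>0 n>0
  lt : p * φ n < N
  lt = <-≤-trans (*-monoʳ-< p {{>-nonZero p>0}} (φ[n]<n (≤-trans (prime>1 pr) (∣⇒≤ {{>-nonZero n>0}} p∣n)))) pn≤N
... | no p∤n = begin-equality
  α (p * n)                                                          ≡⟨ α[n]≡α[φn]+[2∣n] pn>0 ⟩
  α (φ (p * n)) + indicator (2 ∣? (p * n))                           ≡⟨ cong₂ _+_ (cong α (p∤n⇒φ[p*n]≡pred[p]*φ[n] pr p∤n)) ([2∣a*b]≡[2∣a]+[2∣b] notBoth) ⟩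
  α (pred p * φ n) + (indicator (2 ∣? p) + indicator (2 ∣? n))       ≡⟨ cong (_+ (indicator (2 ∣? p) + indicator (2 ∣? n))) (additive (pred-mono-≤ (prime>1 pr)) (φ[n]>0 n>0) lt) ⟩
  α (pred p) + α (φ n) + (indicator (2 ∣? p) + indicator (2 ∣? n))  ≡⟨ interchange (α (pred p)) _ _ _ ⟩
  (α (pred p) + indicator (2 ∣? p)) + (α (φ n) + indicator (2 ∣? n)) ≡⟨ cong₂ _+_ (α[p]≡α[p∸1]+[2∣p] pr) (α[n]≡α[φn]+[2∣n] n>0) ⟨
  α p + α n                                                          ∎
  where
  pn>0 : 0 < p * n
  pn>0 = *-mono-≤ (prime>0 pr) n>0
  notBoth : ¬ (2 ∣ p × 2 ∣ n)
  notBoth (2∣p , 2∣n) = p∤n (subst (_∣ n) (sym (2∣p⇒p≡2 pr 2∣p)) 2∣n)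
  lt : pred p * φ n < N
  lt = <-≤-trans (≤-<-trans (*-monoʳ-≤ (pred p) (φ[n]≤n n)) (*-monoˡ-< n {{>-nonZero n>0}} (pred[n]<n (prime>0 pr)))) pn≤N

α-additive : ∀ N → AdditiveBelow N
α-additive zero _ _ ()
α-additive (suc N) {suc zero} {b} _ _ _ = cong α (*-identityˡ b)
α-additive (suc N) {a@(suc (suc _))} {b} a>0 b>0 (s≤s ab≤N) with primeFactor {a} (s≤s (s≤s z≤n))
... | p , a′ , pr , a≡pa′ = begin-equality
  α (a * b)              ≡⟨ cong α pa′b≡ab ⟨
  α (p * (a′ * b))       ≡⟨ α[p*n]≡α[p]+α[n] (α-additive N) pr a′b>0 pa′b≤N ⟩
  α p + α (a′ * b)       ≡⟨ cong (α p +_) (α-additive N a′>0 b>0 (<-≤-trans (m<p*m pr a′b>0) pa′b≤N)) ⟩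
  α p + (α a′ + α b)     ≡⟨ +-assoc (α p) (α a′) (α b) ⟨
  α p + α a′ + α b       ≡⟨ cong (_+ α b) (α[p*n]≡α[p]+α[n] (α-additive N) pr a′>0 pa′≤N) ⟨
  α (p * a′) + α b       ≡⟨ cong (λ x → α x + α b) a≡pa′ ⟨
  α a + α b              ∎
  where
  a′>0 : 0 < a′
  a′>0 = m*n>0⇒n>0 p (subst (0 <_) a≡pa′ a>0)
  a′b>0 : 0 < a′ * b
  a′b>0 = *-mono-≤ a′>0 b>0
  pa′b≡ab : p * (a′ * b) ≡ a * b
  pa′b≡ab = trans (sym (*-assoc p a′ b)) (cong (_* b) (sym a≡pa′))
  pa′b≤N : p * (a′ * b) ≤ N
  pa′b≤N = subst (_≤ N) (sym pa′b≡ab) ab≤N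
  pa′≤N : p * a′ ≤ N
  pa′≤N = subst (_≤ N) a≡pa′ (≤-trans (m≤m*n a b {{>-nonZero b>0}}) ab≤N)

α-* : ∀ {a b} → 0 < a → 0 < b → α (a * b) ≡ α a + α b
α-* {a} {b} a>0 b>0 = α-additive (suc (a * b)) a>0 b>0 ≤-refl

α[3^i]≡i : ∀ i → α (3 ^ i) ≡ i
α[3^i]≡i zero    = refl
α[3^i]≡i (suc i) = trans (α-* {3} z<s (m^n>0 3 i)) (cong suc (α[3^i]≡i i))

3^α-* : ∀ {a b} → 0 < a → 0 < b → 3 ^ α (a * b) ≡ 3 ^ α a * 3 ^ α b
3^α-* {a} {b} a>0 b>0 = trans (cong (3 ^_) (α-* a>0 b>0)) (^-distribˡ-+-* 3 (α a) (α b))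

α[1+2q]≡1+α[q] : ∀ {q} → Prime (suc (2 * q)) → 0 < q → α (suc (2 * q)) ≡ suc (α q)
α[1+2q]≡1+α[q] {q} pr q>0 = begin-equality
  α (suc (2 * q))                            ≡⟨ α[p]≡α[p∸1]+[2∣p] pr ⟩
  α (2 * q) + indicator (2 ∣? suc (2 * q))   ≡⟨ cong₂ _+_ (α-* {2} z<s q>0) (indicator-no (2 ∣? suc (2 * q)) (2∤1+2*q q)) ⟩
  suc (α q) + 0                              ≡⟨ +-identityʳ _ ⟩
  suc (α q)                                  ∎

H[2*m]≡1+α[m] : 0 < m → H (2 * m) ≡ suc (α m)
H[2*m]≡1+α[m] {m} m>0 = trans (H≡α (m∣m*n m)) (α-* {2} z<s m>0)

-- Comparing n with 3 ^ α n

n≤3^α[n] : 0 < n → n ≤ 3 ^ α n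
n≤3^α[n] = factor-induction (λ n → n ≤ 3 ^ α n) (s≤s z≤n) step
  where
  prime-bound : Prime p → (∀ {k} → 0 < k → k < p → k ≤ 3 ^ α k) → p ≤ 3 ^ α p
  prime-bound {p} pr ih with p ≟ 2
  ... | yes refl = s≤s (s≤s z≤n)
  ... | no p≢2 with odd-prime≡1+2q pr p≢2
  ... | q , q>0 , refl = begin
    suc (2 * q)      ≤⟨ +-monoˡ-≤ (2 * q) q>0 ⟩
    3 * q            ≤⟨ *-monoʳ-≤ 3 (ih q>0 (s≤s (m≤m+n q (q + 0)))) ⟩
    3 ^ suc (α q)    ≡⟨ cong (3 ^_) (α[1+2q]≡1+α[q] pr q>0) ⟨
    3 ^ α (suc (2 * q)) ∎
  step : ∀ {p m} → Prime p → 0 < m → (∀ {k} → 0 < k → k < p → k ≤ 3 ^ α k) → m ≤ 3 ^ α m → p * m ≤ 3 ^ α (p * m)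
  step {p} {m} pr m>0 ih< ih = subst (p * m ≤_) (sym (3^α-* (prime>0 pr) m>0)) (*-mono-≤ (prime-bound pr ih<) ih)

PowerOf3 : Pred ℕ 0ℓ
PowerOf3 n = ∃[ i ] n ≡ 3 ^ i

9*[1+2q]≤7*[3*3^α[q]] : ∀ {q} → q ≢ 1 → 0 < q → PowerOf3 q ⊎ 9 * q ≤ 7 * 3 ^ α q →
  9 * suc (2 * q) ≤ 7 * (3 * 3 ^ α q)
9*[1+2q]≤7*[3*3^α[q]] q≢1 _ (inj₁ (zero , refl)) = contradiction refl q≢1
9*[1+2q]≤7*[3*3^α[q]] {q} _ _ (inj₁ (suc j , refl)) = begin
  9 * suc (2 * q)        ≡⟨ e₁ q ⟩
  9 + 18 * q             ≤⟨ +-monoˡ-≤ (18 * q) (*-monoʳ-≤ 3 (*-monoʳ-≤ 3 (m^n>0 3 j))) ⟩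
  3 * q + 18 * q         ≡⟨ e₂ q ⟩
  7 * (3 * q)            ≡⟨ cong (λ i → 7 * (3 * 3 ^ i)) (α[3^i]≡i (suc j)) ⟨
  7 * (3 * 3 ^ α q)      ∎
  where
  e₁ : ∀ q → 9 * suc (2 * q) ≡ 9 + 18 * q
  e₁ = solve-∀
  e₂ : ∀ q → 3 * q + 18 * q ≡ 7 * (3 * q)
  e₂ = solve-∀
9*[1+2q]≤7*[3*3^α[q]] {q} _ q>0 (inj₂ 9q≤7·3^αq) = begin
  9 * suc (2 * q)        ≡⟨ e₁ q ⟩
  9 + 18 * q             ≤⟨ +-monoˡ-≤ (18 * q) (*-monoʳ-≤ 9 q>0) ⟩
  9 * q + 18 * q         ≡⟨ e₂ q ⟩
  3 * (9 * q)            ≤⟨ *-monoʳ-≤ 3 9q≤7·3^αq ⟩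
  3 * (7 * 3 ^ α q)      ≡⟨ e₃ (3 ^ α q) ⟩
  7 * (3 * 3 ^ α q)      ∎
  where
  e₁ : ∀ q → 9 * suc (2 * q) ≡ 9 + 18 * q
  e₁ = solve-∀
  e₂ : ∀ q → 9 * q + 18 * q ≡ 3 * (9 * q)
  e₂ = solve-∀
  e₃ : ∀ t → 3 * (7 * t) ≡ 7 * (3 * t)
  e₃ = solve-∀

powerOf3⊎9*n≤7*3^α[n] : 0 < n → PowerOf3 n ⊎ 9 * n ≤ 7 * 3 ^ α n
powerOf3⊎9*n≤7*3^α[n] = factor-induction (λ n → PowerOf3 n ⊎ 9 * n ≤ 7 * 3 ^ α n) (inj₁ (0 , refl)) step
  where
  prime-bound : Prime p → p ≢ 3 → (∀ {k} → 0 < k → k < p → PowerOf3 k ⊎ 9 * k ≤ 7 * 3 ^ α k) → 9 * p ≤ 7 * 3 ^ α p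
  prime-bound {p} pr p≢3 below with p ≟ 2
  ... | yes refl = m≤m+n 18 3
  ... | no p≢2 with odd-prime≡1+2q pr p≢2
  ... | q , q>0 , refl = subst (λ i → 9 * p ≤ 7 * 3 ^ i) (sym (α[1+2q]≡1+α[q] pr q>0))
    (9*[1+2q]≤7*[3*3^α[q]] (λ q≡1 → p≢3 (cong (λ x → suc (2 * x)) q≡1)) q>0 (below q>0 (s≤s (m≤m+n q (q + 0)))))
  step : ∀ {p m} → Prime p → 0 < m → (∀ {k} → 0 < k → k < p → PowerOf3 k ⊎ 9 * k ≤ 7 * 3 ^ α k) →
    PowerOf3 m ⊎ 9 * m ≤ 7 * 3 ^ α m → PowerOf3 (p * m) ⊎ 9 * (p * m) ≤ 7 * 3 ^ α (p * m)
  step {p} {m} pr m>0 ih< ih with p ≟ 3 | ih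
  ... | yes refl | inj₁ (i , m≡3^i) = inj₁ (suc i , cong (3 *_) m≡3^i)
  ... | yes refl | inj₂ 9m≤7·3^αm   = inj₂ (begin
    9 * (3 * m)            ≡⟨ e₁ m ⟩
    3 * (9 * m)            ≤⟨ *-monoʳ-≤ 3 9m≤7·3^αm ⟩
    3 * (7 * 3 ^ α m)      ≡⟨ e₂ (3 ^ α m) ⟩
    7 * (3 * 3 ^ α m)      ≡⟨ cong (λ e → 7 * 3 ^ e) (α-* {3} z<s m>0) ⟨
    7 * 3 ^ α (3 * m)      ∎)
    where
    e₁ : ∀ m → 9 * (3 * m) ≡ 3 * (9 * m)
    e₁ = solve-∀
    e₂ : ∀ t → 3 * (7 * t) ≡ 7 * (3 * t)
    e₂ = solve-∀
  ... | no p≢3   | _ = inj₂ (begin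
    9 * (p * m)            ≡⟨ *-assoc 9 p m ⟨
    9 * p * m              ≤⟨ *-mono-≤ (prime-bound pr p≢3 ih<) (n≤3^α[n] m>0) ⟩
    7 * 3 ^ α p * 3 ^ α m  ≡⟨ *-assoc 7 (3 ^ α p) (3 ^ α m) ⟩
    7 * (3 ^ α p * 3 ^ α m) ≡⟨ cong (7 *_) (3^α-* (prime>0 pr) m>0) ⟨
    7 * 3 ^ α (p * m)      ∎)

P̂-form : InPhat p → ∃[ j ] p ≡ suc (2 * 3 ^ j)
P̂-form (_ , j , _ , p≡2*3^[j∸2]+1) = j ∸ 2 , trans p≡2*3^[j∸2]+1 (+-comm _ 1)

1+2*3^j∈P̂ : ∀ {j} → Prime (suc (2 * 3 ^ j)) → InPhat (suc (2 * 3 ^ j))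
1+2*3^j∈P̂ {j} pr = pr , 2 + j , s≤s (s≤s z≤n) , +-comm 1 (2 * 3 ^ j)

α[1+2*3^j]≡1+j : ∀ {j} → Prime (suc (2 * 3 ^ j)) → α (suc (2 * 3 ^ j)) ≡ suc j
α[1+2*3^j]≡1+j {j} pr = trans (α[1+2q]≡1+α[q] pr (m^n>0 3 j)) (cong suc (α[3^i]≡i j))

H[1+2*3^j]≡2+j : ∀ {j} → Prime (suc (2 * 3 ^ j)) → H (suc (2 * 3 ^ j)) ≡ 2 + j
H[1+2*3^j]≡2+j {j} pr =
  trans (H≡1+α (s≤s (≤-trans (m^n>0 3 j) (m≤m+n (3 ^ j) _))) (2∤1+2*q (3 ^ j))) (cong suc (α[1+2*3^j]≡1+j pr))

P̂⊎3*p<2*3^α[p] : Prime p → p ≢ 2 → InPhat p ⊎ 3 * p < 2 * 3 ^ α p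
P̂⊎3*p<2*3^α[p] pr p≢2 with odd-prime≡1+2q pr p≢2
... | q , q>0 , refl with powerOf3⊎9*n≤7*3^α[n] q>0
... | inj₁ (j , refl)  = inj₁ (1+2*3^j∈P̂ {j} pr)
... | inj₂ 9q≤7·3^αq   = inj₂ (*-cancelˡ-< 7 _ _ (begin-strict
  7 * (3 * suc (2 * q))    ≡⟨ e₁ q ⟩
  21 + 42 * q              <⟨ +-monoˡ-< (42 * q) (<-≤-trans (m≤m+n 22 2) (*-monoʳ-≤ 12 q≥2)) ⟩
  12 * q + 42 * q          ≡⟨ e₂ q ⟩
  6 * (9 * q)              ≤⟨ *-monoʳ-≤ 6 9q≤7·3^αq ⟩
  6 * (7 * 3 ^ α q)        ≡⟨ e₃ (3 ^ α q) ⟩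
  7 * (2 * (3 * 3 ^ α q))  ≡⟨ cong (λ e → 7 * (2 * 3 ^ e)) (α[1+2q]≡1+α[q] pr q>0) ⟨
  7 * (2 * 3 ^ α (suc (2 * q))) ∎))
  where
  q≥2 : 2 ≤ q
  q≥2 = ≤∧≢⇒< q>0 (λ 1≡q → from-no (9 ≤? 7) (subst (λ x → 9 * x ≤ 7 * 3 ^ α x) (sym 1≡q) 9q≤7·3^αq))
  e₁ : ∀ q → 7 * (3 * suc (2 * q)) ≡ 21 + 42 * q
  e₁ = solve-∀
  e₂ : ∀ q → 12 * q + 42 * q ≡ 6 * (9 * q)
  e₂ = solve-∀
  e₃ : ∀ t → 6 * (7 * t) ≡ 7 * (2 * (3 * t))
  e₃ = solve-∀

data Extremal : ℕ → Set where
  pow3      : ∀ i → Extremal (3 ^ i)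
  twicePow3 : ∀ i → Extremal (2 * 3 ^ i)
  pow3*P̂   : ∀ i {p} → InPhat p → Extremal (3 ^ i * p)

extremal-3* : Extremal m → Extremal (3 * m)
extremal-3* (pow3 i)         = pow3 (suc i)
extremal-3* (twicePow3 i)    = subst Extremal (e (3 ^ i)) (twicePow3 (suc i))
  where
  e : ∀ t → 2 * (3 * t) ≡ 3 * (2 * t)
  e = solve-∀
extremal-3* (pow3*P̂ i pp)    = subst Extremal (*-assoc 3 (3 ^ i) _) (pow3*P̂ (suc i) pp)

3*a<2*3^α[a]⇒3*[a*m]<2*3^α[a*m] : ∀ {a} → 0 < a → 0 < m → 3 * a < 2 * 3 ^ α a → 3 * (a * m) < 2 * 3 ^ α (a * m)
3*a<2*3^α[a]⇒3*[a*m]<2*3^α[a*m] {m} {a} a>0 m>0 3a<2·3^αa = begin-strict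
  3 * (a * m)              ≡⟨ *-assoc 3 a m ⟨
  3 * a * m                <⟨ *-monoˡ-< m {{>-nonZero m>0}} 3a<2·3^αa ⟩
  2 * 3 ^ α a * m          ≤⟨ *-monoʳ-≤ (2 * 3 ^ α a) (n≤3^α[n] m>0) ⟩
  2 * 3 ^ α a * 3 ^ α m    ≡⟨ *-assoc 2 (3 ^ α a) (3 ^ α m) ⟩
  2 * (3 ^ α a * 3 ^ α m)  ≡⟨ cong (2 *_) (3^α-* a>0 m>0) ⟨
  2 * 3 ^ α (a * m)        ∎

-- For p = 1 + 2X ∈ P̂ with X ≥ 3 one has 3 ^ α p = 3X; a cofactor m that is not a power of 3
-- loses the factor 7/9, which outweighs 3 p / (2 · 3 ^ α p) = (1 + 2X)/(2X) ≤ 7/6.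
P̂-cofactor : ∀ {X T} → 3 ≤ X → 0 < m → 9 * m ≤ 7 * T → 3 * (suc (2 * X) * m) < 2 * (3 * X * T)
P̂-cofactor {m} {X} {T} X≥3 m>0 9m≤7T = *-cancelˡ-< 7 _ _ (*-cancelʳ-< (6 * X) _ _ (begin-strict
  7 * (3 * (suc (2 * X) * m)) * (6 * X)  ≡⟨ e₁ X m ⟩
  (21 + 42 * X) * (6 * X * m)             <⟨ *-monoˡ-< (6 * X * m) {{>-nonZero (*-mono-≤ (*-mono-≤ {1} {6} z<s (<-trans z<s X≥3)) m>0)}} 21+42X<54X ⟩
  54 * X * (6 * X * m)                    ≡⟨ e₂ X m ⟩
  6 * X * (9 * m) * (6 * X)               ≤⟨ *-monoˡ-≤ (6 * X) (*-monoʳ-≤ (6 * X) 9m≤7T) ⟩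
  6 * X * (7 * T) * (6 * X)               ≡⟨ cong (_* (6 * X)) (e₃ X T) ⟩
  7 * (2 * (3 * X * T)) * (6 * X)          ∎))
  where
  e₁ : ∀ X m → 7 * (3 * (suc (2 * X) * m)) * (6 * X) ≡ (21 + 42 * X) * (6 * X * m)
  e₁ = solve-∀
  e₂ : ∀ X m → 54 * X * (6 * X * m) ≡ 6 * X * (9 * m) * (6 * X)
  e₂ = solve-∀
  e₃ : ∀ X T → 6 * X * (7 * T) ≡ 7 * (2 * (3 * X * T))
  e₃ = solve-∀
  e₄ : ∀ X → 12 * X + 42 * X ≡ 54 * X
  e₄ = solve-∀
  21+42X<54X : 21 + 42 * X < 54 * X
  21+42X<54X = <-≤-trans (+-monoˡ-< (42 * X) (<-≤-trans (m≤m+n 22 14) (*-monoʳ-≤ 12 X≥3))) (≤-reflexive (e₄ X))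

extremal : 0 < m → 2 * 3 ^ α m ≤ 3 * m → Extremal m
extremal = factor-induction (λ m → 2 * 3 ^ α m ≤ 3 * m → Extremal m) (λ _ → pow3 0) step
  where
  step : ∀ {p m} → Prime p → 0 < m → (∀ {k} → 0 < k → k < p → 2 * 3 ^ α k ≤ 3 * k → Extremal k) →
    (2 * 3 ^ α m ≤ 3 * m → Extremal m) → 2 * 3 ^ α (p * m) ≤ 3 * (p * m) → Extremal (p * m)
  step {p} {m} pr m>0 _ ih h with p ≟ 3 | p ≟ 2
  ... | yes refl | _ = extremal-3* (ih (*-cancelˡ-≤ 3 (subst (_≤ 3 * (3 * m)) (e (3 ^ α m)) h′)))
    where
    h′ : 2 * (3 * 3 ^ α m) ≤ 3 * (3 * m)
    h′ = subst (λ x → 2 * 3 ^ x ≤ 3 * (3 * m)) (α-* {3} z<s m>0) h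
    e : ∀ t → 2 * (3 * t) ≡ 3 * (2 * t)
    e = solve-∀
  ... | no _ | yes refl with powerOf3⊎9*n≤7*3^α[n] m>0
  ...   | inj₁ (i , refl) = twicePow3 i
  ...   | inj₂ 9m≤7·3^αm = contradiction (≤-trans 9m≤7·3^αm (*-monoʳ-≤ 7 3^αm≤m)) (<⇒≱ (*-monoˡ-< m {{>-nonZero m>0}} (m≤m+n 8 1)))
    where
    3^αm≤m : 3 ^ α m ≤ m
    3^αm≤m = *-cancelˡ-≤ 6 (subst₂ _≤_ (e₁ (3 ^ α m)) (e₂ m) (subst (λ x → 2 * 3 ^ x ≤ 3 * (2 * m)) (α-* {2} z<s m>0) h))
      where
      e₁ : ∀ t → 2 * (3 * t) ≡ 6 * t
      e₁ = solve-∀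
      e₂ : ∀ m → 3 * (2 * m) ≡ 6 * m
      e₂ = solve-∀
  step {p} {m} pr m>0 _ ih h | no p≢3 | no p≢2 with P̂⊎3*p<2*3^α[p] pr p≢2 | powerOf3⊎9*n≤7*3^α[n] m>0
  ... | inj₂ 3p<2·3^αp | _ = contradiction h (<⇒≱ (3*a<2*3^α[a]⇒3*[a*m]<2*3^α[a*m] (prime>0 pr) m>0 3p<2·3^αp))
  ... | inj₁ pp | inj₁ (i , refl) = subst Extremal (*-comm (3 ^ i) p) (pow3*P̂ i pp)
  ... | inj₁ pp | inj₂ 9m≤7·3^αm with P̂-form pp
  ...   | zero  , refl = contradiction refl p≢3
  ...   | suc j , refl = contradiction h (<⇒≱ (begin-strict
    3 * (p * m)                  <⟨ P̂-cofactor (*-monoʳ-≤ 3 (m^n>0 3 j)) m>0 9m≤7·3^αm ⟩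
    2 * (3 ^ suc (suc j) * 3 ^ α m) ≡⟨ cong (λ x → 2 * (3 ^ x * 3 ^ α m)) (α[1+2*3^j]≡1+j {suc j} pr) ⟨
    2 * (3 ^ α p * 3 ^ α m)      ≡⟨ cong (2 *_) (3^α-* (prime>0 pr) m>0) ⟨
    2 * 3 ^ α (p * m)            ∎))

-- The largest elements of C_k

3∈P̂ : InPhat 3
3∈P̂ = 1+2*3^j∈P̂ {0} (from-yes (prime? 3))

P̂-H-mono : ∀ {q} → InPhat p → InPhat q → p < q → H p < H q
P̂-H-mono pp pq p<q with P̂-form pp | P̂-form pq
... | i , refl | j , refl = subst₂ _<_ (sym (H[1+2*3^j]≡2+j (proj₁ pp))) (sym (H[1+2*3^j]≡2+j (proj₁ pq))) (+-monoʳ-< 2 i<j)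
  where
  i<j : i < j
  i<j = ≰⇒> (λ j≤i → <⇒≱ (*-cancelˡ-< 2 (3 ^ i) (3 ^ j) (s≤s⁻¹ p<q)) (^-monoʳ-≤ 3 j≤i))

P̂-candidate≡ : ∀ {k} → InPhat p → H p ≤ k →
  2 * 3 ^ (k ∸ H p) * p ≡ 2 ^ 2 * 3 ^ (k ∸ 2) + 2 * 3 ^ (k ∸ H p)
P̂-candidate≡ {p} {k} pp Hp≤k with P̂-form pp
... | j , refl = begin-equality
  2 * 3 ^ i * p                          ≡⟨ e (3 ^ i) (3 ^ j) ⟩
  2 ^ 2 * (3 ^ i * 3 ^ j) + 2 * 3 ^ i    ≡⟨ cong (λ x → 2 ^ 2 * x + 2 * 3 ^ i) (^-distribˡ-+-* 3 i j) ⟨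
  2 ^ 2 * 3 ^ (i + j) + 2 * 3 ^ i        ≡⟨ cong (λ x → 2 ^ 2 * 3 ^ x + 2 * 3 ^ i) k∸2≡i+j ⟨
  2 ^ 2 * 3 ^ (k ∸ 2) + 2 * 3 ^ i        ∎
  where
  i : ℕ
  i = k ∸ H p
  e : ∀ x y → 2 * x * suc (2 * y) ≡ 2 ^ 2 * (x * y) + 2 * x
  e = solve-∀
  k∸2≡i+j : k ∸ 2 ≡ i + j
  k∸2≡i+j = begin-equality
    k ∸ 2              ≡⟨ cong (_∸ 2) (m∸n+n≡m Hp≤k) ⟨
    (i + H p) ∸ 2      ≡⟨ cong (λ h → (i + h) ∸ 2) (H[1+2*3^j]≡2+j (proj₁ pp)) ⟩
    (i + (2 + j)) ∸ 2  ≡⟨ cong (_∸ 2) (+-comm i (2 + j)) ⟩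
    j + i              ≡⟨ +-comm j i ⟩
    i + j              ∎

P̂-candidate∈C : ∀ {k} → InPhat p → H p ≤ k → InC k (2 * 3 ^ (k ∸ H p) * p)
P̂-candidate∈C {p} {k} pp@(pr , _) Hp≤k with P̂-form pp
... | j , refl = *-mono-≤ (*-mono-≤ {1} {2} z<s 3^i>0) (prime>0 pr) , (begin-equality
  H (2 * 3 ^ i * p)        ≡⟨ cong H (*-assoc 2 (3 ^ i) p) ⟩
  H (2 * (3 ^ i * p))      ≡⟨ H[2*m]≡1+α[m] (*-mono-≤ 3^i>0 (prime>0 pr)) ⟩
  suc (α (3 ^ i * p))      ≡⟨ cong suc (α-* 3^i>0 (prime>0 pr)) ⟩
  suc (α (3 ^ i) + α p)    ≡⟨ cong₂ (λ a b → suc (a + b)) (α[3^i]≡i i) (α[1+2*3^j]≡1+j pr) ⟩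
  suc (i + suc j)          ≡⟨ +-suc i (suc j) ⟨
  i + (2 + j)              ≡⟨ cong (i +_) (H[1+2*3^j]≡2+j pr) ⟨
  i + H p                  ≡⟨ m∸n+n≡m Hp≤k ⟩
  k                        ∎)
  where
  i : ℕ
  i = k ∸ H p
  3^i>0 : 0 < 3 ^ i
  3^i>0 = m^n>0 3 i

4*3^[k∸2]<P̂-candidate : ∀ {k} → InPhat p → H p ≤ k → 2 ^ 2 * 3 ^ (k ∸ 2) < 2 * 3 ^ (k ∸ H p) * p
4*3^[k∸2]<P̂-candidate {p} {k} pp Hp≤k = subst (2 ^ 2 * 3 ^ (k ∸ 2) <_) (sym (P̂-candidate≡ pp Hp≤k))
  (m<m+n (2 ^ 2 * 3 ^ (k ∸ 2)) (*-mono-≤ {1} {2} z<s (m^n>0 3 (k ∸ H p))))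

P̂-candidate-decreasing : ∀ {k q} → InPhat p → InPhat q → p < q → H p ≤ k → H q ≤ k →
  2 * 3 ^ (k ∸ H q) * q < 2 * 3 ^ (k ∸ H p) * p
P̂-candidate-decreasing {p} {k} {q} pp pq p<q Hp≤k Hq≤k =
  subst₂ _<_ (sym (P̂-candidate≡ pq Hq≤k)) (sym (P̂-candidate≡ pp Hp≤k))
    (+-monoʳ-< (2 ^ 2 * 3 ^ (k ∸ 2)) (*-monoʳ-< 2 (^-monoʳ-< 3 (s≤s (s≤s z≤n)) (∸-monoʳ-< (P̂-H-mono pp pq p<q) Hq≤k))))

4*3^[k∸2]∈C : ∀ {k} → 2 ≤ k → InC k (2 ^ 2 * 3 ^ (k ∸ 2))
4*3^[k∸2]∈C {suc zero}    (s≤s ())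
4*3^[k∸2]∈C {suc (suc t)} _ = *-mono-≤ {1} {4} z<s (m^n>0 3 t) , (begin-equality
  H (4 * 3 ^ t)            ≡⟨ cong H (*-assoc 2 2 (3 ^ t)) ⟩
  H (2 * (2 * 3 ^ t))      ≡⟨ H[2*m]≡1+α[m] (*-mono-≤ {1} {2} z<s (m^n>0 3 t)) ⟩
  suc (α (2 * 3 ^ t))      ≡⟨ cong suc (α-* {2} z<s (m^n>0 3 t)) ⟩
  suc (suc (α (3 ^ t)))    ≡⟨ cong (suc ∘ suc) (α[3^i]≡i t) ⟩
  suc (suc t)              ∎)

Candidate : ℕ → ℕ → Set
Candidate k n = (∃[ p ] InPhat p × H p ≤ k × n ≡ 2 * 3 ^ (k ∸ H p) * p) ⊎ n ≡ 2 ^ 2 * 3 ^ (k ∸ 2)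

extremal⇒candidate : ∀ {t} → Extremal m → α m ≡ suc t → Candidate (2 + t) (2 * m)
extremal⇒candidate {t = t} (pow3 i) α≡1+t = inj₁ (3 , 3∈P̂ , s≤s (s≤s z≤n) , (begin-equality
  2 * 3 ^ i             ≡⟨ cong (λ x → 2 * 3 ^ x) i≡1+t ⟩
  2 * (3 * 3 ^ t)       ≡⟨ e (3 ^ t) ⟩
  2 * 3 ^ t * 3         ∎))
  where
  i≡1+t : i ≡ suc t
  i≡1+t = trans (sym (α[3^i]≡i i)) α≡1+t
  e : ∀ x → 2 * (3 * x) ≡ 2 * x * 3
  e = solve-∀
extremal⇒candidate {t = t} (twicePow3 i) α≡1+t = inj₂ (begin-equality
  2 * (2 * 3 ^ i)       ≡⟨ *-assoc 2 2 (3 ^ i) ⟨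
  2 ^ 2 * 3 ^ i         ≡⟨ cong (λ x → 2 ^ 2 * 3 ^ x) i≡t ⟩
  2 ^ 2 * 3 ^ t         ∎)
  where
  i≡t : i ≡ t
  i≡t = suc-injective (trans (sym (trans (α-* {2} z<s (m^n>0 3 i)) (cong suc (α[3^i]≡i i)))) α≡1+t)
extremal⇒candidate {t = t} (pow3*P̂ i {p} pp@(pr , _)) α≡1+t with P̂-form pp
... | j , refl = inj₁ (p , pp , Hp≤2+t , (begin-equality
  2 * (3 ^ i * p)          ≡⟨ *-assoc 2 (3 ^ i) p ⟨
  2 * 3 ^ i * p            ≡⟨ cong (λ x → 2 * 3 ^ x * p) 2+t∸Hp≡i ⟨
  2 * 3 ^ (2 + t ∸ H p) * p ∎))
  where
  i+j≡t : i + j ≡ t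
  i+j≡t = suc-injective (begin-equality
    suc (i + j)            ≡⟨ +-suc i j ⟨
    i + suc j              ≡⟨ cong₂ _+_ (α[3^i]≡i i) (α[1+2*3^j]≡1+j {j} pr) ⟨
    α (3 ^ i) + α p        ≡⟨ α-* (m^n>0 3 i) (prime>0 pr) ⟨
    α (3 ^ i * p)          ≡⟨ α≡1+t ⟩
    suc t                  ∎)
  Hp≤2+t : H p ≤ 2 + t
  Hp≤2+t = subst (_≤ 2 + t) (sym (H[1+2*3^j]≡2+j {j} pr)) (+-monoʳ-≤ 2 (subst (j ≤_) i+j≡t (m≤n+m j i)))
  2+t∸Hp≡i : 2 + t ∸ H p ≡ i
  2+t∸Hp≡i = begin-equality
    2 + t ∸ H p            ≡⟨ cong (2 + t ∸_) (H[1+2*3^j]≡2+j {j} pr) ⟩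
    t ∸ j                  ≡⟨ cong (_∸ j) i+j≡t ⟨
    i + j ∸ j              ≡⟨ m+n∸n≡m i j ⟩
    i                      ∎

large∈C⇒candidate : ∀ {k} → 2 < k → InC k n → 2 ^ 2 * 3 ^ (k ∸ 2) ≤ n → Candidate k n
large∈C⇒candidate {k = suc zero} (s≤s ())
large∈C⇒candidate {n} {suc (suc t)} _ (n>0 , Hn≡k) large with 2 ∣? n
... | no 2∤n = contradiction large (<⇒≱ (begin-strict
  n          ≤⟨ n≤3^α[n] n>0 ⟩
  3 ^ α n    ≡⟨ cong (3 ^_) α≡1+t ⟩
  3 * 3 ^ t  <⟨ *-monoˡ-< (3 ^ t) {{>-nonZero (m^n>0 3 t)}} {3} {4} ≤-refl ⟩
  4 * 3 ^ t  ∎))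
  where
  α≡1+t : α n ≡ suc t
  α≡1+t = suc-injective (trans (sym (H≡1+α (H>0⇒n≥2 {n} n>0 (subst (0 <_) (sym Hn≡k) z<s)) 2∤n)) Hn≡k)
... | yes (divides m refl) = subst (Candidate (2 + t)) (*-comm 2 m) (extremal⇒candidate (extremal m>0 2*3^αm≤3*m) α≡1+t)
  where
  m>0 : 0 < m
  m>0 = m*n>0⇒n>0 2 (subst (0 <_) (*-comm m 2) n>0)
  α≡1+t : α m ≡ suc t
  α≡1+t = suc-injective (trans (sym (H[2*m]≡1+α[m] m>0)) (trans (cong H (*-comm 2 m)) Hn≡k))
  2*3^αm≤3*m : 2 * 3 ^ α m ≤ 3 * m
  2*3^αm≤3*m = begin
    2 * 3 ^ α m        ≡⟨ cong (λ x → 2 * 3 ^ x) α≡1+t ⟩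
    2 * (3 * 3 ^ t)    ≡⟨ e (3 ^ t) ⟩
    3 * (2 * 3 ^ t)    ≤⟨ *-monoʳ-≤ 3 (*-cancelˡ-≤ {2 * 3 ^ t} {m} 2 (subst₂ _≤_ (*-assoc 2 2 (3 ^ t)) (*-comm m 2) large)) ⟩
    3 * m              ∎
    where
    e : ∀ x → 2 * (3 * x) ≡ 3 * (2 * x)
    e = solve-∀

corollary3p4 : (k : ℕ) → 2 < k →
    ((p : ℕ) → InPhat p → H p ≤ k →
        InC k (2 * 3 ^ (k ∸ H p) * p) × (2 ^ 2 * 3 ^ (k ∸ 2) < 2 * 3 ^ (k ∸ H p) * p))
    × ((p q : ℕ) → InPhat p → InPhat q → p < q → H p ≤ k → H q ≤ k →
        2 * 3 ^ (k ∸ H q) * q < 2 * 3 ^ (k ∸ H p) * p)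
    × InC k (2 ^ 2 * 3 ^ (k ∸ 2))
    × ((n : ℕ) → InC k n →
        ((p : ℕ) → InPhat p → H p ≤ k → n ≢ 2 * 3 ^ (k ∸ H p) * p) →
        n ≢ 2 ^ 2 * 3 ^ (k ∸ 2) →
        n < 2 ^ 2 * 3 ^ (k ∸ 2))
corollary3p4 k k>2 =
    (λ p pp Hp≤k → P̂-candidate∈C pp Hp≤k , 4*3^[k∸2]<P̂-candidate pp Hp≤k)
  , (λ p q pp pq p<q Hp≤k Hq≤k → P̂-candidate-decreasing pp pq p<q Hp≤k Hq≤k)
  , 4*3^[k∸2]∈C (<⇒≤ k>2)
  , λ n n∈C n≢P̂-candidate n≢4*3^[k∸2] → ≰⇒> λ large →
      [ (λ (p , pp , Hp≤k , n≡) → n≢P̂-candidate p pp Hp≤k n≡) , n≢4*3^[k∸2] ]′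
        (large∈C⇒candidate k>2 n∈C large)
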